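{- Let $M$ be a matroid of rank 3 with ground set $[n]$. If $M$ has no minor isomorphic to $Q_6$, then $\kappa(M)\le 41+n$.
   Context: $Q_6$ is the simple rank-3 matroid on $\{a,b,c,d,e,f\}$ whose only dependent 3-element sets are $\{a,b,c\}$ and $\{a,d,e\}$. A non-basis of $M$ is a set of size $r(M)$ that is not a basis. A flat $F$ covers $X$ if $|X\cap F|>r_M(F)$. A flat cover is a set of flats covering every non-basis; $\kappa(M)$ is the minimum size of a flat cover of $M$. -}

module Defs where

open import Data.Nat using (ℕ; zero; suc; _+_; _∸_; _≤_; _<_; _≤ᵇ_)
open import Data.Bool using (Bool; true; false; if_then_else_; _∨_)
import Data.Bool.Properties as BoolP
open import Data.Fin using (Fin; zero; suc)
open import Data.Fin.Subset using (Subset; _∪_; _∩_; ∁; ⁅_⁆; ∣_∣; _∈_; _∉_; ⊤; ⊥; _⊆_)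
open import Data.Vec using (Vec; []; _∷_)
open import Data.Vec.Properties using (≡-dec)
open import Data.List using (List; length)
open import Data.List.Relation.Unary.All using (All)
open import Data.List.Relation.Unary.Any using (Any)
open import Data.Product using (Σ; _×_; _,_)
open import Function.Definitions using (Injective)
open import Relation.Nullary.Decidable using (does)
open import Relation.Binary.PropositionalEquality using (_≡_)

record Matroid (n : ℕ) : Set where
  field
    rank       : Subset n → ℕ
    rank-≤-card : ∀ X → rank X ≤ ∣ X ∣
    rank-mono  : ∀ {X Y} → X ⊆ Y → rank X ≤ rank Y
    rank-submod : ∀ X Y → rank (X ∪ Y) + rank (X ∩ Y) ≤ rank X + rank Y
open Matroid public

r[_] : ∀ {n} → Matroid n → ℕ
r[ M ] = rank M ⊤

IsFlat : ∀ {n} → Matroid n → Subset n → Set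
IsFlat M F = ∀ e → e ∉ F → rank M F < rank M (F ∪ ⁅ e ⁆)

IsNonBasis : ∀ {n} → Matroid n → Subset n → Set
IsNonBasis M X = (∣ X ∣ ≡ r[ M ]) × (rank M X < ∣ X ∣)

Covers : ∀ {n} → Matroid n → Subset n → Subset n → Set
Covers M F X = rank M F < ∣ X ∩ F ∣

IsFlatCover : ∀ {n} → Matroid n → List (Subset n) → Set
IsFlatCover {n} M Fs =
  All (IsFlat M) Fs × (∀ X → IsNonBasis M X → Any (λ F → Covers M F X) Fs)

-- κ(M) ≤ k  :⇔  there is a flat cover of size at most k
-- (κ(M) is the minimum size of a flat cover)
κ≤ : ∀ {n} → Matroid n → ℕ → Set
κ≤ {n} M k = Σ (List (Subset n)) λ Fs → IsFlatCover M Fs × (length Fs ≤ k)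

-- The matroid Q₆ on {a,b,c,d,e,f} = Fin 6 (a=0,…,f=5):
-- simple, rank 3, only dependent 3-sets {a,b,c} and {a,d,e}.
-- Its rank function: r(X) = |X| if |X| ≤ 2; 2 if X ∈ {abc, ade}; 3 otherwise.

abc ade : Subset 6
abc = true ∷ true ∷ true ∷ false ∷ false ∷ false ∷ []
ade = true ∷ false ∷ false ∷ true ∷ true ∷ false ∷ []

_≟ˢ_ : (X Y : Subset 6) → _
_≟ˢ_ = ≡-dec BoolP._≟_

rankQ6 : Subset 6 → ℕ
rankQ6 X =
  if ∣ X ∣ ≤ᵇ 2 then ∣ X ∣
  else (if does (X ≟ˢ abc) ∨ does (X ≟ˢ ade) then 2 else 3)

image : ∀ {m n} → (Fin m → Fin n) → Subset m → Subset n
image {zero}  φ []      = ⊥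
image {suc m} φ (b ∷ X) =
  (if b then ⁅ φ zero ⁆ else ⊥) ∪ image (λ i → φ (suc i)) X

-- For disjoint C, D ⊆ E, the minor M / C \ D has ground set
-- E − (C ∪ D) and rank function X ↦ r(X ∪ C) − r(C).

HasQ6Minor : ∀ {n} → Matroid n → Set
HasQ6Minor {n} M =
  Σ (Subset n) λ C → Σ (Subset n) λ D → Σ (Fin 6 → Fin n) λ φ →
    (C ∩ D ≡ ⊥) × Injective _≡_ _≡_ φ × (image φ ⊤ ≡ ∁ (C ∪ D)) ×
    (∀ X → rank M (image φ X ∪ C) ∸ rank M C ≡ rankQ6 X)

-- Choose a representative in every parallel class.  The flats cl{e} of the other elements cover
-- every non-basis containing a loop or two parallel elements, so it remains to cover the
-- non-bases spanning a long line (a rank-2 flat with three parallel classes), for which a flat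
-- cl{u,v} with u, v on the line suffices.  If no two long lines meet, each representative lying
-- on a long line records one of them: n flats in all.  Otherwise take long lines abc and ade
-- through a and record {a,e} for each representative e, which spans every long line through a.
-- A point f off both lines lies on one of bd, be, cd, ce, since otherwise a,…,f span a Q₆
-- restriction.  Pigeonholing with this fact leaves at most two such points on each of the four
-- lines and at most three further points on abc and on ade when f exists.  A long line missing a
-- contains two of the (at most 8) off points or one point of each of abc, ade and an off point,
-- which adds at most 28 + 9 flats.

module Submission where

open import Defs
open import Data.Bool using (true; false)
open import Data.Bool.Properties using (T-≡)
open import Data.Empty using () renaming (⊥-elim to ⊥-elim)
open import Data.Fin using (Fin; zero; suc; #_; fromℕ<; inject) renaming (_≟_ to _≟ᶠ_)
import Data.Fin.Properties as Finₚ
open import Data.Fin.Subset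
  using (Subset; _∪_; _∩_; _─_; _-_; ∁; ⁅_⁆; ∣_∣; _∈_; _∉_; ⊤; ⊥; _⊆_)
open import Data.Fin.Subset.Properties
open import Data.List using (List; []; _∷_; length; map; _++_; filter; allFin; cartesianProductWith)
open import Data.List.Properties using (length-map; length-++; length-tabulate)
open import Data.List.Relation.Unary.All as All using (All; []; _∷_)
open import Data.List.Relation.Unary.Any as Any using (Any; here; there)
import Data.List.Relation.Unary.Any.Properties as Anyₚ
import Data.List.Relation.Unary.All.Properties as Allₚ
open import Data.List.Relation.Unary.AllPairs using ([]; _∷_)
open import Data.List.Relation.Unary.Unique.Propositional using (Unique)
import Data.List.Relation.Unary.Unique.Propositional.Properties as Uniqueₚ
open import Data.List.Membership.Propositional using (lose) renaming (_∈_ to _∈ₗ_)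
open import Data.List.Membership.Propositional.Properties
  using (∈-map⁺; ∈-++⁺ˡ; ∈-++⁺ʳ; ∈-filter⁺; ∈-filter⁻; ∈-allFin; ∈-cartesianProductWith⁺)
open import Data.Nat using (ℕ; zero; suc; _+_; _*_; _∸_; _≤_; _<_; z≤n; s≤s; _≤?_; _≟_; _≤ᵇ_)
open import Data.Nat.Properties
open import Data.Nat.Combinatorics using (_C_; nC1≡n; nCk+nC[k+1]≡[n+1]C[k+1])
open import Data.Product using (∃-syntax; _×_; _,_; proj₁; proj₂)
open import Data.Sum using (_⊎_; inj₁; inj₂; [_,_])
open import Data.Vec using ([]; _∷_; tabulate; here; there)
open import Data.Vec.Properties using (lookup∘tabulate; lookup⇒[]=; []=⇒lookup)
open import Function using (id; _∘_; _$_; Equivalence)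
open import Relation.Binary.Definitions using (tri<; tri≈; tri>)
open import Relation.Binary.PropositionalEquality hiding ([_])
open import Relation.Nullary using (¬_; Dec; yes; no; ¬?)
open import Relation.Nullary.Decidable using (map′; _×-dec_; _⊎-dec_; _→-dec_; decidable-stable; from-yes)
open import Relation.Unary using (Decidable)

⁅_·_⁆ : ∀ {n} → Fin n → Fin n → Subset n
⁅ x · y ⁆ = ⁅ x ⁆ ∪ ⁅ y ⁆

⁅_·_·_⁆ : ∀ {n} → Fin n → Fin n → Fin n → Subset n
⁅ x · y · z ⁆ = ⁅ x ⁆ ∪ ⁅ y · z ⁆

x∈p─q⇒x∉q : ∀ {n} {p q : Subset n} {x} → x ∈ p ─ q → x ∉ q
x∈p─q⇒x∉q {p = true ∷ p} {false ∷ q} here ()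
x∈p─q⇒x∉q {p = _ ∷ p} {_ ∷ q}     (there x∈p─q) (there x∈q) = x∈p─q⇒x∉q x∈p─q x∈q

remove-element : ∀ {n} (p : Subset n) {k} → ∣ p ∣ ≡ suc k → ∃[ x ] x ∈ p × ∣ p - x ∣ ≡ k
remove-element (true ∷ p)  ∣p∣≡1+k = zero , here , trans (cong ∣_∣ (p─⊥≡p p)) (suc-injective ∣p∣≡1+k)
remove-element (false ∷ p) ∣p∣≡1+k with remove-element p ∣p∣≡1+k
... | x , x∈p , ∣p-x∣≡k = suc x , there x∈p , ∣p-x∣≡k

module _ {n : ℕ} where

  ∈-∪⁺ˡ : ∀ {p q : Subset n} {x} → x ∈ p → x ∈ p ∪ q
  ∈-∪⁺ˡ = x∈p∪q⁺ ∘ inj₁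

  ∈-∪⁺ʳ : ∀ {p q : Subset n} {x} → x ∈ q → x ∈ p ∪ q
  ∈-∪⁺ʳ = x∈p∪q⁺ ∘ inj₂

  ∈⁅·⁆ˡ : ∀ {x y : Fin n} → x ∈ ⁅ x · y ⁆
  ∈⁅·⁆ˡ {x} = ∈-∪⁺ˡ (x∈⁅x⁆ x)

  ∈⁅·⁆ʳ : ∀ {x y : Fin n} → y ∈ ⁅ x · y ⁆
  ∈⁅·⁆ʳ {y = y} = ∈-∪⁺ʳ (x∈⁅x⁆ y)

  ∈⁅··⁆₁ : ∀ {x y z : Fin n} → x ∈ ⁅ x · y · z ⁆
  ∈⁅··⁆₁ {x} = ∈-∪⁺ˡ (x∈⁅x⁆ x)

  ∈⁅··⁆₂ : ∀ {x y z : Fin n} → y ∈ ⁅ x · y · z ⁆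
  ∈⁅··⁆₂ = ∈-∪⁺ʳ ∈⁅·⁆ˡ

  ∈⁅··⁆₃ : ∀ {x y z : Fin n} → z ∈ ⁅ x · y · z ⁆
  ∈⁅··⁆₃ = ∈-∪⁺ʳ ∈⁅·⁆ʳ

  ∈⁅·⁆⁻ : ∀ {x y e : Fin n} → e ∈ ⁅ x · y ⁆ → e ≡ x ⊎ e ≡ y
  ∈⁅·⁆⁻ {x} {y} p = Data.Sum.map (x∈⁅y⁆⇒x≡y x) (x∈⁅y⁆⇒x≡y y) (x∈p∪q⁻ ⁅ x ⁆ ⁅ y ⁆ p)

  ∈⁅··⁆⁻ : ∀ {x y z e : Fin n} → e ∈ ⁅ x · y · z ⁆ → e ≡ x ⊎ e ≡ y ⊎ e ≡ z
  ∈⁅··⁆⁻ {x} {y} {z} p = Data.Sum.map (x∈⁅y⁆⇒x≡y x) ∈⁅·⁆⁻ (x∈p∪q⁻ ⁅ x ⁆ ⁅ y · z ⁆ p)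

  ⁅⁆⊆ : ∀ {x : Fin n} {S} → x ∈ S → ⁅ x ⁆ ⊆ S
  ⁅⁆⊆ {S = S} x∈S e∈⁅x⁆ = subst (_∈ S) (sym (x∈⁅y⁆⇒x≡y _ e∈⁅x⁆)) x∈S

  ⁅·⁆⊆ : ∀ {x y : Fin n} {S} → x ∈ S → y ∈ S → ⁅ x · y ⁆ ⊆ S
  ⁅·⁆⊆ x∈S y∈S e∈ with ∈⁅·⁆⁻ e∈
  ... | inj₁ refl = x∈S
  ... | inj₂ refl = y∈S

  ⁅··⁆⊆ : ∀ {x y z : Fin n} {S} → x ∈ S → y ∈ S → z ∈ S → ⁅ x · y · z ⁆ ⊆ S
  ⁅··⁆⊆ x∈S y∈S z∈S e∈ with ∈⁅··⁆⁻ e∈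
  ... | inj₁ refl = x∈S
  ... | inj₂ (inj₁ refl) = y∈S
  ... | inj₂ (inj₂ refl) = z∈S

  p⊆q∪p─q : ∀ (p q : Subset n) → p ⊆ q ∪ (p ─ q)
  p⊆q∪p─q p q {x} x∈p with x ∈? q
  ... | yes x∈q = ∈-∪⁺ˡ x∈q
  ... | no  x∉q = ∈-∪⁺ʳ (x∈p∧x∉q⇒x∈p─q x∈p x∉q)

  1≤∣p∣ : ∀ {p : Subset n} {x} → x ∈ p → 1 ≤ ∣ p ∣
  1≤∣p∣ {x = x} x∈p = subst (_≤ _) (∣⁅x⁆∣≡1 x) (p⊆q⇒∣p∣≤∣q∣ (⁅⁆⊆ x∈p))

  2≤∣p∣ : ∀ {p : Subset n} {x y} → x ≢ y → x ∈ p → y ∈ p → 2 ≤ ∣ p ∣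
  2≤∣p∣ x≢y x∈p y∈p =
    ≤-trans (s≤s (1≤∣p∣ (x∈p∧x≢y⇒x∈p-y y∈p (x≢y ∘ sym)))) (x∈p⇒∣p-x∣<∣p∣ x∈p)

  3≤∣p∣ : ∀ {p : Subset n} {x y z} → x ≢ y → x ≢ z → y ≢ z → x ∈ p → y ∈ p → z ∈ p → 3 ≤ ∣ p ∣
  3≤∣p∣ x≢y x≢z y≢z x∈p y∈p z∈p =
    ≤-trans (s≤s (2≤∣p∣ y≢z (x∈p∧x≢y⇒x∈p-y y∈p (x≢y ∘ sym)) (x∈p∧x≢y⇒x∈p-y z∈p (x≢z ∘ sym))))
            (x∈p⇒∣p-x∣<∣p∣ x∈p)

  x∈p-y⇒x≢y : ∀ {p : Subset n} {x y} → x ∈ p - y → x ≢ y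
  x∈p-y⇒x≢y = x∉⁅y⁆⇒x≢y ∘ x∈p─q⇒x∉q

  three-elements : ∀ (p : Subset n) → ∣ p ∣ ≡ 3 →
                   ∃[ x ] ∃[ y ] ∃[ z ] x ≢ y × x ≢ z × y ≢ z × x ∈ p × y ∈ p × z ∈ p
  three-elements p ∣p∣≡3 with remove-element p ∣p∣≡3
  ... | x , x∈p , ∣p-x∣≡2 with remove-element (p - x) ∣p-x∣≡2
  ...   | y , y∈p-x , ∣p-x-y∣≡1 with remove-element (p - x - y) ∣p-x-y∣≡1
  ...     | z , z∈p-x-y , _ =
    x , y , z , x≢y , x≢z , y≢z , x∈p , p─q⊆p p _ y∈p-x , p─q⊆p p _ (p─q⊆p (p - x) _ z∈p-x-y)
    where
    x≢y = (x∈p-y⇒x≢y y∈p-x) ∘ sym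
    x≢z = (x∈p-y⇒x≢y (p─q⊆p (p - x) _ z∈p-x-y)) ∘ sym
    y≢z = (x∈p-y⇒x≢y z∈p-x-y) ∘ sym

all-subsets? : ∀ {n} {P : Subset n → Set} → Decidable P → Dec (∀ X → P X)
all-subsets? P? with anySubset? (¬? ∘ P?)
... | yes (X , ¬PX) = no λ ∀P → ¬PX (∀P X)
... | no ¬∃¬P = yes λ X → decidable-stable (P? X) (λ ¬PX → ¬∃¬P (X , ¬PX))

MonochromaticPair : ∀ {A : Set} → (Member P Q : A → Set) → Set
MonochromaticPair Member P Q = ∃[ x ] ∃[ y ] Member x × Member y × x ≢ y × (P x × P y ⊎ Q x × Q y)

module _ {A : Set} {Member P Q : A → Set} where

  pair-among-three : ∀ {x y z} → Member x → Member y → Member z → x ≢ y → x ≢ z → y ≢ z →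
                     P x ⊎ Q x → P y ⊎ Q y → P z ⊎ Q z → MonochromaticPair Member P Q
  pair-among-three mx my mz dxy dxz dyz (inj₁ px) (inj₁ py) _         = _ , _ , mx , my , dxy , inj₁ (px , py)
  pair-among-three mx my mz dxy dxz dyz (inj₂ qx) (inj₂ qy) _         = _ , _ , mx , my , dxy , inj₂ (qx , qy)
  pair-among-three mx my mz dxy dxz dyz (inj₁ px) (inj₂ _)  (inj₁ pz) = _ , _ , mx , mz , dxz , inj₁ (px , pz)
  pair-among-three mx my mz dxy dxz dyz (inj₁ _)  (inj₂ qy) (inj₂ qz) = _ , _ , my , mz , dyz , inj₂ (qy , qz)
  pair-among-three mx my mz dxy dxz dyz (inj₂ _)  (inj₁ py) (inj₁ pz) = _ , _ , my , mz , dyz , inj₁ (py , pz)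
  pair-among-three mx my mz dxy dxz dyz (inj₂ qx) (inj₁ _)  (inj₂ qz) = _ , _ , mx , mz , dxz , inj₂ (qx , qz)

  -- If every two distinct members include a coloured one, then at most one of four members is
  -- uncoloured, and two of the remaining three share a colour.
  monochromatic-pair : (∀ x → Dec (P x ⊎ Q x)) →
    (∀ {x y} → Member x → Member y → x ≢ y → (P x ⊎ Q x) ⊎ (P y ⊎ Q y)) →
    ∀ {x₁ x₂ x₃ x₄} → Member x₁ → Member x₂ → Member x₃ → Member x₄ →
    x₁ ≢ x₂ → x₁ ≢ x₃ → x₁ ≢ x₄ → x₂ ≢ x₃ → x₂ ≢ x₄ → x₃ ≢ x₄ → MonochromaticPair Member P Q
  monochromatic-pair coloured? some-coloured {x₁} {x₂} {x₃} m₁ m₂ m₃ m₄ d₁₂ d₁₃ d₁₄ d₂₃ d₂₄ d₃₄ =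
    by-cases (coloured? x₁) (coloured? x₂) (coloured? x₃)
    where
    other : ∀ {x y} → Member x → Member y → x ≢ y → ¬ (P x ⊎ Q x) → P y ⊎ Q y
    other mx my x≢y ¬cx = [ (λ cx → ⊥-elim (¬cx cx)) , id ] (some-coloured mx my x≢y)
    by-cases : Dec (P x₁ ⊎ Q x₁) → Dec (P x₂ ⊎ Q x₂) → Dec (P x₃ ⊎ Q x₃) → MonochromaticPair Member P Q
    by-cases (no ¬c₁) _ _ =
      pair-among-three m₂ m₃ m₄ d₂₃ d₂₄ d₃₄ (other m₁ m₂ d₁₂ ¬c₁) (other m₁ m₃ d₁₃ ¬c₁) (other m₁ m₄ d₁₄ ¬c₁)
    by-cases (yes c₁) (no ¬c₂) _ =
      pair-among-three m₁ m₃ m₄ d₁₃ d₁₄ d₃₄ c₁ (other m₂ m₃ d₂₃ ¬c₂) (other m₂ m₄ d₂₄ ¬c₂)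
    by-cases (yes c₁) (yes c₂) (yes c₃) = pair-among-three m₁ m₂ m₃ d₁₂ d₁₃ d₂₃ c₁ c₂ c₃
    by-cases (yes c₁) (yes c₂) (no ¬c₃) =
      pair-among-three m₁ m₂ m₄ d₁₂ d₁₄ d₂₄ c₁ c₂ (other m₃ m₄ d₃₄ ¬c₃)

module _ {A B : Set} where

  pairsWith : (A → A → B) → List A → List B
  pairsWith f []       = []
  pairsWith f (x ∷ xs) = map (f x) xs ++ pairsWith f xs

  length-pairsWith : ∀ f xs → length (pairsWith f xs) ≡ length xs C 2
  length-pairsWith f []       = refl
  length-pairsWith f (x ∷ xs) = begin
    length (map (f x) xs ++ pairsWith f xs)         ≡⟨ length-++ (map (f x) xs) ⟩
    length (map (f x) xs) + length (pairsWith f xs) ≡⟨ cong₂ _+_ (length-map (f x) xs) (length-pairsWith f xs) ⟩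
    length xs + length xs C 2                       ≡⟨ cong (_+ length xs C 2) (sym (nC1≡n (length xs))) ⟩
    length xs C 1 + length xs C 2                   ≡⟨ nCk+nC[k+1]≡[n+1]C[k+1] (length xs) 1 ⟩
    suc (length xs) C 2                             ∎
    where open ≡-Reasoning

  ∈-pairsWith : ∀ f {xs x y} → x ∈ₗ xs → y ∈ₗ xs → x ≢ y →
                f x y ∈ₗ pairsWith f xs ⊎ f y x ∈ₗ pairsWith f xs
  ∈-pairsWith f (here refl) (here refl) x≢y = ⊥-elim (x≢y refl)
  ∈-pairsWith f (here refl) (there y∈)  _   = inj₁ (∈-++⁺ˡ (∈-map⁺ (f _) y∈))
  ∈-pairsWith f (there x∈)  (here refl) _   = inj₂ (∈-++⁺ˡ (∈-map⁺ (f _) x∈))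
  ∈-pairsWith f {z ∷ xs} (there x∈) (there y∈) x≢y =
    Data.Sum.map (∈-++⁺ʳ (map (f z) xs)) (∈-++⁺ʳ (map (f z) xs)) (∈-pairsWith f x∈ y∈ x≢y)

  length-cartesianProductWith : ∀ (f : A → A → B) xs ys →
                                length (cartesianProductWith f xs ys) ≡ length xs * length ys
  length-cartesianProductWith f []       ys = refl
  length-cartesianProductWith f (x ∷ xs) ys = begin
    length (map (f x) ys ++ cartesianProductWith f xs ys)         ≡⟨ length-++ (map (f x) ys) ⟩
    length (map (f x) ys) + length (cartesianProductWith f xs ys) ≡⟨ cong₂ _+_ (length-map (f x) ys)
                                                                       (length-cartesianProductWith f xs ys) ⟩
    length ys + length xs * length ys                             ∎
    where open ≡-Reasoning

C2-mono : ∀ {m n} → m ≤ n → m C 2 ≤ n C 2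
C2-mono {zero}          _         = z≤n
C2-mono {suc m} {suc n} (s≤s m≤n) =
  subst₂ _≤_ (pascal m) (pascal n) (+-mono-≤ m≤n (C2-mono m≤n))
  where
  pascal : ∀ k → k + k C 2 ≡ suc k C 2
  pascal k = trans (cong (_+ k C 2) (sym (nC1≡n k))) (nCk+nC[k+1]≡[n+1]C[k+1] k 1)

module _ {A : Set} {P Q R : A → Set} (P? : Decidable P) (Q? : Decidable Q) (R? : Decidable R) where

  length-filter-⊎ : (∀ {x} → P x → Q x ⊎ R x) → ∀ xs →
                    length (filter P? xs) ≤ length (filter Q? xs) + length (filter R? xs)
  length-filter-⊎ P⇒Q⊎R []       = z≤n
  length-filter-⊎ P⇒Q⊎R (x ∷ xs) with ih ← length-filter-⊎ P⇒Q⊎R xs | P? x | Q? x | R? x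
  ... | no _   | no _  | no _  = ih
  ... | no _   | no _  | yes _ = ≤-trans (m≤n⇒m≤1+n ih) (≤-reflexive (sym (+-suc _ _)))
  ... | no _   | yes _ | no _  = m≤n⇒m≤1+n ih
  ... | no _   | yes _ | yes _ = m≤n⇒m≤1+n (≤-trans (m≤n⇒m≤1+n ih) (≤-reflexive (sym (+-suc _ _))))
  ... | yes _  | yes _ | no _  = s≤s ih
  ... | yes _  | yes _ | yes _ = s≤s (≤-trans (m≤n⇒m≤1+n ih) (≤-reflexive (sym (+-suc _ _))))
  ... | yes _  | no _  | yes _ = ≤-trans (s≤s ih) (≤-reflexive (sym (+-suc _ _)))
  ... | yes px | no ¬q | no ¬r = ⊥-elim ([ ¬q , ¬r ] (P⇒Q⊎R px))

module _ {A : Set} where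

  Unique-length≤2 : ∀ {xs : List A} → Unique xs →
    (∀ {x y z} → x ∈ₗ xs → y ∈ₗ xs → z ∈ₗ xs → ¬ (x ≢ y × x ≢ z × y ≢ z)) → length xs ≤ 2
  Unique-length≤2 {[]}                _ _ = z≤n
  Unique-length≤2 {_ ∷ []}            _ _ = s≤s z≤n
  Unique-length≤2 {_ ∷ _ ∷ []}        _ _ = s≤s (s≤s z≤n)
  Unique-length≤2 {_ ∷ _ ∷ _ ∷ _} ((x≢y ∷ x≢z ∷ _) ∷ (y≢z ∷ _) ∷ _) no-three =
    ⊥-elim (no-three (here refl) (there (here refl)) (there (there (here refl))) (x≢y , x≢z , y≢z))

  Unique-length≤3 : ∀ {xs : List A} → Unique xs →
    (∀ {x₁ x₂ x₃ x₄} → x₁ ∈ₗ xs → x₂ ∈ₗ xs → x₃ ∈ₗ xs → x₄ ∈ₗ xs →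
       ¬ (x₁ ≢ x₂ × x₁ ≢ x₃ × x₁ ≢ x₄ × x₂ ≢ x₃ × x₂ ≢ x₄ × x₃ ≢ x₄)) → length xs ≤ 3
  Unique-length≤3 {[]}                _ _ = z≤n
  Unique-length≤3 {_ ∷ []}            _ _ = s≤s z≤n
  Unique-length≤3 {_ ∷ _ ∷ []}        _ _ = s≤s (s≤s z≤n)
  Unique-length≤3 {_ ∷ _ ∷ _ ∷ []}    _ _ = s≤s (s≤s (s≤s z≤n))
  Unique-length≤3 {_ ∷ _ ∷ _ ∷ _ ∷ _}
    ((d₁₂ ∷ d₁₃ ∷ d₁₄ ∷ _) ∷ (d₂₃ ∷ d₂₄ ∷ _) ∷ (d₃₄ ∷ _) ∷ _) no-four =
    ⊥-elim (no-four (here refl) (there (here refl)) (there (there (here refl)))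
                    (there (there (there (here refl)))) (d₁₂ , d₁₃ , d₁₄ , d₂₃ , d₂₄ , d₃₄))

module _ {n : ℕ} {P : Fin n → Set} (P? : Decidable P) where

  ∈-filter-allFin⁻ : ∀ {x} → x ∈ₗ filter P? (allFin n) → P x
  ∈-filter-allFin⁻ = proj₂ ∘ ∈-filter⁻ P? {xs = allFin n}

  filter-allFin-unique : Unique (filter P? (allFin n))
  filter-allFin-unique = Uniqueₚ.filter⁺ P? (Uniqueₚ.allFin⁺ n)

image⁺ : ∀ {m n} (φ : Fin m → Fin n) {X i} → i ∈ X → φ i ∈ image φ X
image⁺ φ {true ∷ X} here      = ∈-∪⁺ˡ (x∈⁅x⁆ (φ zero))
image⁺ φ {b ∷ X}    (there p) = ∈-∪⁺ʳ (image⁺ (φ ∘ suc) p)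

image⁻ : ∀ {m n} (φ : Fin m → Fin n) X {e} → e ∈ image φ X → ∃[ i ] i ∈ X × e ≡ φ i
image⁻ φ [] p = ⊥-elim (∉⊥ p)
image⁻ φ (true ∷ X) p with x∈p∪q⁻ ⁅ φ zero ⁆ (image (φ ∘ suc) X) p
... | inj₁ q = zero , here , x∈⁅y⁆⇒x≡y _ q
... | inj₂ q with image⁻ (φ ∘ suc) X q
...   | i , i∈X , refl = suc i , there i∈X , refl
image⁻ φ (false ∷ X) p with x∈p∪q⁻ ⊥ (image (φ ∘ suc) X) p
... | inj₁ q = ⊥-elim (∉⊥ q)
... | inj₂ q with image⁻ (φ ∘ suc) X q
...   | i , i∈X , refl = suc i , there i∈X , refl

image-⊆ : ∀ {m n} (φ : Fin m → Fin n) {X S} → (∀ {i} → i ∈ X → φ i ∈ S) → image φ X ⊆ S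
image-⊆ φ {X} h p with image⁻ φ X p
... | i , i∈X , refl = h i∈X

image-∪ : ∀ {m n} (φ : Fin m → Fin n) X Y → image φ (X ∪ Y) ⊆ image φ X ∪ image φ Y
image-∪ φ X Y = image-⊆ φ λ {i} i∈X∪Y → [ ∈-∪⁺ˡ ∘ image⁺ φ , ∈-∪⁺ʳ ∘ image⁺ φ ] (x∈p∪q⁻ X Y i∈X∪Y)

triple : Fin 6 × Fin 6 × Fin 6 → Subset 6
triple (i , j , k) = ⁅ i · j · k ⁆

q6-bases : List (Fin 6 × Fin 6 × Fin 6)
q6-bases =
  (# 0 , # 1 , # 3) ∷ (# 0 , # 1 , # 4) ∷ (# 0 , # 1 , # 5) ∷ (# 0 , # 2 , # 3) ∷
  (# 0 , # 2 , # 4) ∷ (# 0 , # 2 , # 5) ∷ (# 0 , # 3 , # 5) ∷ (# 0 , # 4 , # 5) ∷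
  (# 1 , # 2 , # 3) ∷ (# 1 , # 2 , # 4) ∷ (# 1 , # 2 , # 5) ∷ (# 1 , # 3 , # 4) ∷
  (# 1 , # 3 , # 5) ∷ (# 1 , # 4 , # 5) ∷ (# 2 , # 3 , # 4) ∷ (# 2 , # 3 , # 5) ∷
  (# 2 , # 4 , # 5) ∷ (# 3 , # 4 , # 5) ∷ []

-- A basis T with r(X) + ∣T ─ X∣ ≤ 3 bounds the rank of X from below wherever T stays independent.
-- Both facts are checked by evaluation; opaque, so that unification never re-runs the check.
opaque
  rankQ6-lower-witness : ∀ X → Any (λ t → rankQ6 X + ∣ triple t ─ X ∣ ≤ 3) q6-bases
  rankQ6-lower-witness = from-yes (all-subsets? λ X → Any.any? (λ t → rankQ6 X + ∣ triple t ─ X ∣ ≤? 3) q6-bases)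

  rankQ6-pair : ∀ i j → i ≢ j → rankQ6 ⁅ i · j ⁆ ≡ 2
  rankQ6-pair = from-yes (Finₚ.all? λ i → Finₚ.all? λ j →
    ¬? (i ≟ᶠ j) →-dec (rankQ6 ⁅ i · j ⁆ ≟ 2))

module MatroidTheory {n : ℕ} (M : Matroid n) where

  rk : Subset n → ℕ
  rk = rank M

  rank-⊥ : rk ⊥ ≡ 0
  rank-⊥ = n≤0⇒n≡0 (≤-trans (rank-≤-card M ⊥) (≤-reflexive (∣⊥∣≡0 n)))

  rank-∪-≤ : ∀ X Y → rk (X ∪ Y) ≤ rk X + rk Y
  rank-∪-≤ X Y = ≤-trans (m≤m+n _ _) (rank-submod M X Y)

  rank-⁅⁆ : ∀ x → rk ⁅ x ⁆ ≤ 1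
  rank-⁅⁆ x = ≤-trans (rank-≤-card M _) (≤-reflexive (∣⁅x⁆∣≡1 x))

  rank-⁅·⁆ : ∀ x y → rk ⁅ x · y ⁆ ≤ 2
  rank-⁅·⁆ x y = ≤-trans (rank-∪-≤ _ _) (+-mono-≤ (rank-⁅⁆ x) (rank-⁅⁆ y))

  rank-image-≤ : ∀ {m} (φ : Fin m → Fin n) X → rk (image φ X) ≤ ∣ X ∣
  rank-image-≤ φ [] = ≤-reflexive rank-⊥
  rank-image-≤ φ (true ∷ X) =
    ≤-trans (rank-∪-≤ _ _) (+-mono-≤ (rank-⁅⁆ (φ zero)) (rank-image-≤ (φ ∘ suc) X))
  rank-image-≤ φ (false ∷ X) =
    ≤-trans (≤-reflexive (cong rk (∪-identityˡ _))) (rank-image-≤ (φ ∘ suc) X)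

  Spans : Subset n → Fin n → Set
  Spans X e = rk (X ∪ ⁅ e ⁆) ≤ rk X

  -- Submodularity: r(Z ∪ e) + r(X) ≤ r(Z) + r(X ∪ e) for X ⊆ Z.
  spans-mono : ∀ {X Z e} → X ⊆ Z → Spans X e → Spans Z e
  spans-mono {X} {Z} {e} X⊆Z X↠e = +-cancelʳ-≤ (rk X) _ _ (begin
    rk (Z ∪ ⁅ e ⁆) + rk X                  ≤⟨ +-mono-≤ (rank-mono M Z∪e⊆) (rank-mono M X⊆Z∩[X∪e]) ⟩
    rk (Z ∪ (X ∪ ⁅ e ⁆)) + rk (Z ∩ (X ∪ ⁅ e ⁆)) ≤⟨ rank-submod M Z (X ∪ ⁅ e ⁆) ⟩
    rk Z + rk (X ∪ ⁅ e ⁆)                  ≤⟨ +-monoʳ-≤ (rk Z) X↠e ⟩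
    rk Z + rk X                            ∎)
    where
    open ≤-Reasoning
    Z∪e⊆ : Z ∪ ⁅ e ⁆ ⊆ Z ∪ (X ∪ ⁅ e ⁆)
    Z∪e⊆ p = [ ∈-∪⁺ˡ , ∈-∪⁺ʳ ∘ ∈-∪⁺ʳ ] (x∈p∪q⁻ Z ⁅ e ⁆ p)
    X⊆Z∩[X∪e] : X ⊆ Z ∩ (X ∪ ⁅ e ⁆)
    X⊆Z∩[X∪e] p = x∈p∩q⁺ (X⊆Z p , ∈-∪⁺ˡ p)

  rank-∪-spanned : ∀ X Y → (∀ {e} → e ∈ Y → Spans X e) → rk (X ∪ Y) ≤ rk X
  rank-∪-spanned X Y = go ∣ Y ∣ Y ≤-refl
    where
    go : ∀ k Y → ∣ Y ∣ ≤ k → (∀ {e} → e ∈ Y → Spans X e) → rk (X ∪ Y) ≤ rk X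
    go k Y _ X↠Y with nonempty? Y
    ... | no Y≡∅ = rank-mono M λ {e} p → [ id , (λ e∈Y → ⊥-elim (Y≡∅ (e , e∈Y))) ] (x∈p∪q⁻ X Y p)
    go zero    Y ∣Y∣≤0 X↠Y | yes (y , y∈Y) = ⊥-elim (1+n≰n (≤-trans (1≤∣p∣ y∈Y) ∣Y∣≤0))
    go (suc k) Y ∣Y∣≤k X↠Y | yes (y , y∈Y) = begin
      rk (X ∪ Y)               ≤⟨ rank-mono M X∪Y⊆ ⟩
      rk ((X ∪ (Y - y)) ∪ ⁅ y ⁆) ≤⟨ spans-mono (p⊆p∪q (Y - y)) (X↠Y y∈Y) ⟩
      rk (X ∪ (Y - y))         ≤⟨ go k (Y - y) (≤-pred (≤-trans (x∈p⇒∣p-x∣<∣p∣ y∈Y) ∣Y∣≤k))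
                                      (X↠Y ∘ p─q⊆p Y ⁅ y ⁆) ⟩
      rk X                     ∎
      where
      open ≤-Reasoning
      X∪Y⊆ : X ∪ Y ⊆ (X ∪ (Y - y)) ∪ ⁅ y ⁆
      X∪Y⊆ {e} p with x∈p∪q⁻ X Y p | e ≟ᶠ y
      ... | inj₁ e∈X | _        = ∈-∪⁺ˡ (∈-∪⁺ˡ e∈X)
      ... | inj₂ _   | yes refl = ∈-∪⁺ʳ (x∈⁅x⁆ e)
      ... | inj₂ e∈Y | no e≢y   = ∈-∪⁺ˡ (∈-∪⁺ʳ (x∈p∧x≢y⇒x∈p-y e∈Y e≢y))

  cl : Subset n → Subset n
  cl X = tabulate λ e → rk (X ∪ ⁅ e ⁆) ≤ᵇ rk X

  ∈-cl⁻ : ∀ {X e} → e ∈ cl X → Spans X e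
  ∈-cl⁻ {X} {e} e∈cl = ≤ᵇ⇒≤ _ _ (Equivalence.from T-≡ (trans (sym (lookup∘tabulate _ e)) ([]=⇒lookup e∈cl)))

  ∈-cl⁺ : ∀ {X e} → Spans X e → e ∈ cl X
  ∈-cl⁺ {X} {e} X↠e = lookup⇒[]= e (cl X) (trans (lookup∘tabulate _ e) (Equivalence.to T-≡ (≤⇒≤ᵇ X↠e)))

  X⊆cl[X] : ∀ {X} → X ⊆ cl X
  X⊆cl[X] {X} x∈X = ∈-cl⁺ (rank-mono M λ p → [ id , ⁅⁆⊆ x∈X ] (x∈p∪q⁻ X _ p))

  rank-cl : ∀ X → rk (cl X) ≡ rk X
  rank-cl X = ≤-antisym (≤-trans (rank-mono M (q⊆p∪q X (cl X))) (rank-∪-spanned X (cl X) ∈-cl⁻))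
                        (rank-mono M X⊆cl[X])

  cl-isFlat : ∀ X → IsFlat M (cl X)
  cl-isFlat X e e∉cl = begin-strict
    rk (cl X)          ≡⟨ rank-cl X ⟩
    rk X               <⟨ ≰⇒> (e∉cl ∘ ∈-cl⁺) ⟩
    rk (X ∪ ⁅ e ⁆)     ≤⟨ rank-mono M (λ {x} p → [ ∈-∪⁺ˡ ∘ X⊆cl[X] , ∈-∪⁺ʳ ] (x∈p∪q⁻ X _ p)) ⟩
    rk (cl X ∪ ⁅ e ⁆)  ∎
    where open ≤-Reasoning

  cl-covers : ∀ {W X Z} → W ⊆ X → W ⊆ cl Z → rk Z < ∣ W ∣ → Covers M (cl Z) X
  cl-covers {W} {X} {Z} W⊆X W⊆clZ rZ<∣W∣ = begin-strict
    rk (cl Z)    ≡⟨ rank-cl Z ⟩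
    rk Z         <⟨ rZ<∣W∣ ⟩
    ∣ W ∣        ≤⟨ p⊆q⇒∣p∣≤∣q∣ (λ p → x∈p∩q⁺ (W⊆X p , W⊆clZ p)) ⟩
    ∣ X ∩ cl Z ∣ ∎
    where open ≤-Reasoning

  Nonloop : Fin n → Set
  Nonloop x = 1 ≤ rk ⁅ x ⁆

  Indep : Fin n → Fin n → Set
  Indep x y = 2 ≤ rk ⁅ x · y ⁆

  Parallel : Fin n → Fin n → Set
  Parallel x y = rk ⁅ x · y ⁆ ≤ 1

  Collinear : Fin n → Fin n → Fin n → Set
  Collinear x y z = rk ⁅ x · y · z ⁆ ≤ 2

  nonloop? : ∀ x → Dec (Nonloop x)
  nonloop? x = 1 ≤? rk ⁅ x ⁆

  indep? : ∀ x y → Dec (Indep x y)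
  indep? x y = 2 ≤? rk ⁅ x · y ⁆

  parallel? : ∀ x y → Dec (Parallel x y)
  parallel? x y = rk ⁅ x · y ⁆ ≤? 1

  collinear? : ∀ x y z → Dec (Collinear x y z)
  collinear? x y z = rk ⁅ x · y · z ⁆ ≤? 2

  ¬indep⇒parallel : ∀ {x y} → ¬ Indep x y → Parallel x y
  ¬indep⇒parallel = ≤-pred ∘ ≰⇒>

  indep⇒¬parallel : ∀ {x y} → Indep x y → ¬ Parallel x y
  indep⇒¬parallel 2≤r r≤1 = 1+n≰n (≤-trans 2≤r r≤1)

  indep-sym : ∀ {x y} → Indep x y → Indep y x
  indep-sym h = ≤-trans h (rank-mono M (⁅·⁆⊆ ∈⁅·⁆ʳ ∈⁅·⁆ˡ))

  parallel-sym : ∀ {x y} → Parallel x y → Parallel y x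
  parallel-sym h = ≤-trans (rank-mono M (⁅·⁆⊆ ∈⁅·⁆ʳ ∈⁅·⁆ˡ)) h

  parallel-refl : ∀ x → Parallel x x
  parallel-refl x = ≤-trans (rank-mono M (⁅·⁆⊆ (x∈⁅x⁆ x) (x∈⁅x⁆ x))) (rank-⁅⁆ x)

  indep⇒≢ : ∀ {x y} → Indep x y → x ≢ y
  indep⇒≢ {x} h refl = indep⇒¬parallel h (parallel-refl x)

  parallel-trans : ∀ {x y z} → Nonloop y → Parallel x y → Parallel y z → Parallel x z
  parallel-trans {x} {y} {z} y≠0 x∥y y∥z = begin
    rk ⁅ x · z ⁆            ≤⟨ rank-mono M (q⊆p∪q ⁅ y ⁆ _) ⟩
    rk (⁅ y ⁆ ∪ ⁅ x · z ⁆)  ≤⟨ rank-∪-spanned ⁅ y ⁆ ⁅ x · z ⁆ y↠ ⟩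
    rk ⁅ y ⁆                ≤⟨ rank-⁅⁆ y ⟩
    1                       ∎
    where
    open ≤-Reasoning
    y↠ : ∀ {e} → e ∈ ⁅ x · z ⁆ → Spans ⁅ y ⁆ e
    y↠ e∈ with ∈⁅·⁆⁻ e∈
    ... | inj₁ refl = ≤-trans (parallel-sym x∥y) y≠0
    ... | inj₂ refl = ≤-trans y∥z y≠0

  collinear-⊆ : ∀ {x y z x′ y′ z′} → x′ ∈ ⁅ x · y · z ⁆ → y′ ∈ ⁅ x · y · z ⁆ → z′ ∈ ⁅ x · y · z ⁆ →
                Collinear x y z → Collinear x′ y′ z′
  collinear-⊆ x′∈ y′∈ z′∈ = ≤-trans (rank-mono M (⁅··⁆⊆ x′∈ y′∈ z′∈))

  collinear-⁅·⁆ : ∀ {x y x′ y′ z′} → x′ ∈ ⁅ x · y ⁆ → y′ ∈ ⁅ x · y ⁆ → z′ ∈ ⁅ x · y ⁆ →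
                  Collinear x′ y′ z′
  collinear-⁅·⁆ {x} {y} x′∈ y′∈ z′∈ = ≤-trans (rank-mono M (⁅··⁆⊆ x′∈ y′∈ z′∈)) (rank-⁅·⁆ x y)

  collinear-xyx : ∀ {x y} → Collinear x y x
  collinear-xyx = collinear-⁅·⁆ ∈⁅·⁆ˡ ∈⁅·⁆ʳ ∈⁅·⁆ˡ

  collinear-xyy : ∀ {x y} → Collinear x y y
  collinear-xyy = collinear-⁅·⁆ ∈⁅·⁆ˡ ∈⁅·⁆ʳ ∈⁅·⁆ʳ

  collinear-swap₁₂ : ∀ {x y z} → Collinear x y z → Collinear y x z
  collinear-swap₁₂ = collinear-⊆ ∈⁅··⁆₂ ∈⁅··⁆₁ ∈⁅··⁆₃

  collinear-swap₂₃ : ∀ {x y z} → Collinear x y z → Collinear x z y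
  collinear-swap₂₃ = collinear-⊆ ∈⁅··⁆₁ ∈⁅··⁆₃ ∈⁅··⁆₂

  collinear-rotate : ∀ {x y z} → Collinear x y z → Collinear y z x
  collinear-rotate = collinear-⊆ ∈⁅··⁆₂ ∈⁅··⁆₃ ∈⁅··⁆₁

  collinear⇒spans : ∀ {p q u} → Indep p q → Collinear p q u → Spans ⁅ p · q ⁆ u
  collinear⇒spans {p} {q} {u} p-q pqu = begin
    rk (⁅ p · q ⁆ ∪ ⁅ u ⁆) ≤⟨ rank-mono M (λ e∈ → [ ⁅·⁆⊆ ∈⁅··⁆₁ ∈⁅··⁆₂ , ⁅⁆⊆ ∈⁅··⁆₃ ] (x∈p∪q⁻ ⁅ p · q ⁆ _ e∈)) ⟩
    rk ⁅ p · q · u ⁆       ≤⟨ pqu ⟩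
    2                      ≤⟨ p-q ⟩
    rk ⁅ p · q ⁆           ∎
    where open ≤-Reasoning

  line-unique : ∀ {p q u v w} → Indep p q → Collinear p q u → Collinear p q v → Collinear p q w →
                Collinear u v w
  line-unique {p} {q} {u} {v} {w} p-q pqu pqv pqw = begin
    rk ⁅ u · v · w ⁆               ≤⟨ rank-mono M (q⊆p∪q ⁅ p · q ⁆ _) ⟩
    rk (⁅ p · q ⁆ ∪ ⁅ u · v · w ⁆) ≤⟨ rank-∪-spanned ⁅ p · q ⁆ _ pq↠ ⟩
    rk ⁅ p · q ⁆                   ≤⟨ rank-⁅·⁆ p q ⟩
    2                              ∎
    where
    open ≤-Reasoning
    pq↠ : ∀ {e} → e ∈ ⁅ u · v · w ⁆ → Spans ⁅ p · q ⁆ e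
    pq↠ e∈ with ∈⁅··⁆⁻ e∈
    ... | inj₁ refl        = collinear⇒spans p-q pqu
    ... | inj₂ (inj₁ refl) = collinear⇒spans p-q pqv
    ... | inj₂ (inj₂ refl) = collinear⇒spans p-q pqw

  collinear-on-line : ∀ {a x b d} → Indep a x → Collinear a x b → Collinear a x d → Collinear a b d
  collinear-on-line a-x = line-unique a-x collinear-xyx

  ¬collinear-off-line : ∀ {l m p q u} → Indep l m → Indep p q → Collinear l m p → Collinear l m q →
                        ¬ Collinear l m u → ¬ Collinear p q u
  ¬collinear-off-line l-m p-q lmp lmq ¬lmu pqu =
    ¬lmu (line-unique p-q (line-unique l-m lmp lmq collinear-xyx) (line-unique l-m lmp lmq collinear-xyy) pqu)

  collinear-parallel : ∀ {x y z w} → Indep x y → Collinear x y z → Nonloop z → Parallel z w →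
                       Collinear x y w
  collinear-parallel {x} {y} {z} {w} x-y xyz z≠0 z∥w = begin
    rk ⁅ x · y · w ⁆                ≤⟨ rank-mono M xyw⊆ ⟩
    rk ((⁅ x · y ⁆ ∪ ⁅ z ⁆) ∪ ⁅ w ⁆) ≤⟨ spans-mono (q⊆p∪q ⁅ x · y ⁆ _) (≤-trans z∥w z≠0) ⟩
    rk (⁅ x · y ⁆ ∪ ⁅ z ⁆)          ≤⟨ collinear⇒spans x-y xyz ⟩
    rk ⁅ x · y ⁆                    ≤⟨ rank-⁅·⁆ x y ⟩
    2                               ∎
    where
    open ≤-Reasoning
    xyw⊆ : ⁅ x · y · w ⁆ ⊆ (⁅ x · y ⁆ ∪ ⁅ z ⁆) ∪ ⁅ w ⁆
    xyw⊆ = ⁅··⁆⊆ (∈-∪⁺ˡ (∈-∪⁺ˡ ∈⁅·⁆ˡ)) (∈-∪⁺ˡ (∈-∪⁺ˡ ∈⁅·⁆ʳ)) (∈-∪⁺ʳ (x∈⁅x⁆ w))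

  -- The representative of a parallel class is its element of least index.
  IsRep : Fin n → Set
  IsRep e = Nonloop e × (∀ f → f Data.Fin.< e → Nonloop f → Indep f e)

  isRep? : ∀ e → Dec (IsRep e)
  isRep? e = nonloop? e ×-dec Finₚ.all? λ f → (f Finₚ.<? e) →-dec (nonloop? f →-dec indep? f e)

  rep-indep : ∀ {x y} → IsRep x → IsRep y → x ≢ y → Indep x y
  rep-indep {x} {y} (x≠0 , x-min) (y≠0 , y-min) x≢y with Finₚ.<-cmp x y
  ... | tri< x<y _ _ = y-min x x<y x≠0
  ... | tri≈ _ x≡y _ = ⊥-elim (x≢y x≡y)
  ... | tri> _ _ y<x = indep-sym (x-min y y<x y≠0)

  rep-exists : ∀ {x} → Nonloop x → ∃[ r ] IsRep r × Parallel r x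
  rep-exists {x} x≠0
    with Finₚ.¬∀⟶∃¬-smallest n (λ f → ¬ (Nonloop f × Parallel f x))
           (λ f → ¬? (nonloop? f ×-dec parallel? f x)) (λ all → all x (x≠0 , parallel-refl x))
  ... | r , ¬¬r-like , no-earlier = r , (proj₁ r-like , r-min) , proj₂ r-like
    where
    r-like : Nonloop r × Parallel r x
    r-like = decidable-stable (nonloop? r ×-dec parallel? r x) ¬¬r-like
    r-min : ∀ f → f Data.Fin.< r → Nonloop f → Indep f r
    r-min f f<r f≠0 with indep? f r
    ... | yes f-r = f-r
    ... | no ¬f-r = ⊥-elim $ no-earlier (fromℕ< f<r) (subst (λ g → Nonloop g × Parallel g x) (sym inject≡f)
                      (f≠0 , parallel-trans (proj₁ r-like) (¬indep⇒parallel ¬f-r) (proj₂ r-like)))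
      where
      inject≡f : inject (fromℕ< f<r) ≡ f
      inject≡f = Finₚ.toℕ-injective (trans (Finₚ.toℕ-inject (fromℕ< f<r)) (Finₚ.toℕ-fromℕ< f<r))

  -- A rank-2 flat with at least three parallel classes, given by representatives of three of them.
  record LongLine (x y z : Fin n) : Set where
    constructor longLine
    field
      rep₁ : IsRep x
      rep₂ : IsRep y
      rep₃ : IsRep z
      distinct₁₂ : x ≢ y
      distinct₁₃ : x ≢ z
      distinct₂₃ : y ≢ z
      collinear : Collinear x y z

    indep₁₂ : Indep x y
    indep₁₂ = rep-indep rep₁ rep₂ distinct₁₂

    indep₁₃ : Indep x z
    indep₁₃ = rep-indep rep₁ rep₃ distinct₁₃

    indep₂₃ : Indep y z
    indep₂₃ = rep-indep rep₂ rep₃ distinct₂₃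

  longLine? : ∀ x y z → Dec (LongLine x y z)
  longLine? x y z = map′ (λ (rx , ry , rz , x≢y , x≢z , y≢z , xyz) → longLine rx ry rz x≢y x≢z y≢z xyz)
    (λ (longLine rx ry rz x≢y x≢z y≢z xyz) → rx , ry , rz , x≢y , x≢z , y≢z , xyz)
    (isRep? x ×-dec isRep? y ×-dec isRep? z ×-dec ¬? (x ≟ᶠ y) ×-dec ¬? (x ≟ᶠ z) ×-dec ¬? (y ≟ᶠ z) ×-dec
     collinear? x y z)

  longLine-swap₁₂ : ∀ {x y z} → LongLine x y z → LongLine y x z
  longLine-swap₁₂ (longLine rx ry rz x≢y x≢z y≢z xyz) =
    longLine ry rx rz (x≢y ∘ sym) y≢z x≢z (collinear-swap₁₂ xyz)

  longLine-swap₂₃ : ∀ {x y z} → LongLine x y z → LongLine x z y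
  longLine-swap₂₃ (longLine rx ry rz x≢y x≢z y≢z xyz) =
    longLine rx rz ry x≢z x≢y (y≢z ∘ sym) (collinear-swap₂₃ xyz)

  -- The lines x y and x z coincide.
  longLine-same : ∀ {x y z s} → LongLine x y z → Collinear x z s → Collinear x y s
  longLine-same xyz = collinear-on-line (LongLine.indep₁₃ xyz) (collinear-swap₂₃ (LongLine.collinear xyz))

  TwoLongLines : Fin n → Fin n → Fin n → Fin n → Fin n → Set
  TwoLongLines a b c d e = LongLine a b c × LongLine a d e × ¬ Collinear a b d

  twoLongLines-swap₁ : ∀ {a b c d e} → TwoLongLines a b c d e → TwoLongLines a c b d e
  twoLongLines-swap₁ (abc , ade , ¬abd) = longLine-swap₂₃ abc , ade , ¬abd ∘ longLine-same abc

  twoLongLines-swap₂ : ∀ {a b c d e} → TwoLongLines a b c d e → TwoLongLines a b c e d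
  twoLongLines-swap₂ (abc , ade , ¬abd) =
    abc , longLine-swap₂₃ ade , ¬abd ∘ collinear-swap₂₃ ∘ longLine-same ade ∘ collinear-swap₂₃

  twoLongLines? : Dec (∃[ a ] ∃[ b ] ∃[ c ] ∃[ d ] ∃[ e ] TwoLongLines a b c d e)
  twoLongLines? = Finₚ.any? λ a → Finₚ.any? λ b → Finₚ.any? λ c → Finₚ.any? λ d → Finₚ.any? λ e →
    longLine? a b c ×-dec longLine? a d e ×-dec ¬? (collinear? a b d)

-- Recognising a Q₆ restriction

  module _ (r≡3 : r[ M ] ≡ 3) where

    rank-≤-3 : ∀ X → rk X ≤ 3
    rank-≤-3 X = ≤-trans (rank-mono M ⊆⊤) (≤-reflexive r≡3)

    module Q6Image (φ : Fin 6 → Fin n)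
      (abc-col : Collinear (φ (# 0)) (φ (# 1)) (φ (# 2))) (ade-col : Collinear (φ (# 0)) (φ (# 3)) (φ (# 4)))
      (bases-indep : All (λ (i , j , k) → ¬ Collinear (φ i) (φ j) (φ k)) q6-bases) where

      ρ : Subset 6 → ℕ
      ρ X = rk (image φ X)

      ρ-abc : ρ abc ≤ 2
      ρ-abc = ≤-trans (rank-mono M (image-⊆ φ abc⊆)) abc-col
        where
        abc⊆ : ∀ {i} → i ∈ abc → φ i ∈ ⁅ φ (# 0) · φ (# 1) · φ (# 2) ⁆
        abc⊆ here                 = ∈⁅··⁆₁
        abc⊆ (there here)         = ∈⁅··⁆₂
        abc⊆ (there (there here)) = ∈⁅··⁆₃
        abc⊆ (there (there (there (there (there (there ()))))))

      ρ-ade : ρ ade ≤ 2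
      ρ-ade = ≤-trans (rank-mono M (image-⊆ φ ade⊆)) ade-col
        where
        ade⊆ : ∀ {i} → i ∈ ade → φ i ∈ ⁅ φ (# 0) · φ (# 3) · φ (# 4) ⁆
        ade⊆ here                                 = ∈⁅··⁆₁
        ade⊆ (there (there (there here)))         = ∈⁅··⁆₂
        ade⊆ (there (there (there (there here)))) = ∈⁅··⁆₃
        ade⊆ (there (there (there (there (there (there ()))))))

      ρ-≤-rankQ6 : ∀ X → ρ X ≤ rankQ6 X
      ρ-≤-rankQ6 X with ∣ X ∣ ≤ᵇ 2 | X ≟ˢ abc | X ≟ˢ ade
      ... | true  | _        | _        = rank-image-≤ φ X
      ... | false | yes refl | _        = ρ-abc
      ... | false | no _     | yes refl = ρ-ade
      ... | false | no _     | no _     = rank-≤-3 _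

      ρ-triple : ∀ t → ¬ Collinear (φ (proj₁ t)) (φ (proj₁ (proj₂ t))) (φ (proj₂ (proj₂ t))) →
                 3 ≤ ρ (triple t)
      ρ-triple (i , j , k) ¬col =
        ≤-trans (≰⇒> ¬col) (rank-mono M (⁅··⁆⊆ (image⁺ φ {X} ∈⁅··⁆₁) (image⁺ φ {X} ∈⁅··⁆₂) (image⁺ φ {X} ∈⁅··⁆₃)))
        where X = ⁅ i · j · k ⁆

      rankQ6-≤-ρ : ∀ X → rankQ6 X ≤ ρ X
      rankQ6-≤-ρ X with All.lookupAny bases-indep (rankQ6-lower-witness X)
      ... | ¬col , small = +-cancelʳ-≤ ∣ B ─ X ∣ _ _ (begin
        rankQ6 X + ∣ B ─ X ∣             ≤⟨ small ⟩
        3                                ≤⟨ ρ-triple t ¬col ⟩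
        ρ B                              ≤⟨ rank-mono M (image-⊆ φ (image⁺ φ ∘ p⊆q∪p─q B X)) ⟩
        ρ (X ∪ (B ─ X))                  ≤⟨ rank-mono M (image-∪ φ X (B ─ X)) ⟩
        rk (image φ X ∪ image φ (B ─ X)) ≤⟨ rank-∪-≤ _ _ ⟩
        ρ X + ρ (B ─ X)                  ≤⟨ +-monoʳ-≤ (ρ X) (rank-image-≤ φ (B ─ X)) ⟩
        ρ X + ∣ B ─ X ∣                  ∎)
        where
        open ≤-Reasoning
        t = Any.lookup (rankQ6-lower-witness X)
        B = triple t

      ρ≡rankQ6 : ∀ X → ρ X ≡ rankQ6 X
      ρ≡rankQ6 X = ≤-antisym (ρ-≤-rankQ6 X) (rankQ6-≤-ρ X)

      φ-injective : ∀ {i j} → φ i ≡ φ j → i ≡ j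
      φ-injective {i} {j} φi≡φj with i ≟ᶠ j
      ... | yes i≡j = i≡j
      ... | no  i≢j = ⊥-elim (1+n≰n (begin
        2                  ≡⟨ sym (rankQ6-pair i j i≢j) ⟩
        rankQ6 ⁅ i · j ⁆   ≡⟨ sym (ρ≡rankQ6 ⁅ i · j ⁆) ⟩
        ρ ⁅ i · j ⁆        ≤⟨ rank-mono M (image-⊆ φ ij⊆) ⟩
        rk ⁅ φ i ⁆         ≤⟨ rank-⁅⁆ (φ i) ⟩
        1                  ∎))
        where
        open ≤-Reasoning
        ij⊆ : ∀ {l} → l ∈ ⁅ i · j ⁆ → φ l ∈ ⁅ φ i ⁆
        ij⊆ l∈ with ∈⁅·⁆⁻ l∈
        ... | inj₁ refl = x∈⁅x⁆ (φ i)
        ... | inj₂ refl = subst (_∈ ⁅ φ i ⁆) φi≡φj (x∈⁅x⁆ (φ i))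

      ⊥∪∁∁ : ∁ (⊥ ∪ ∁ (image φ ⊤)) ≡ image φ ⊤
      ⊥∪∁∁ = trans (cong ∁ (∪-identityˡ _)) (∁-involutive _)
        where
        ∁-involutive : ∀ {m} (S : Subset m) → ∁ (∁ S) ≡ S
        ∁-involutive []          = refl
        ∁-involutive (true ∷ S)  = cong (true ∷_) (∁-involutive S)
        ∁-involutive (false ∷ S) = cong (false ∷_) (∁-involutive S)

    q6-minor : (φ : Fin 6 → Fin n) →
               Collinear (φ (# 0)) (φ (# 1)) (φ (# 2)) → Collinear (φ (# 0)) (φ (# 3)) (φ (# 4)) →
               All (λ (i , j , k) → ¬ Collinear (φ i) (φ j) (φ k)) q6-bases → HasQ6Minor M
    q6-minor φ abc-col ade-col bases-indep =
      ⊥ , ∁ (image φ ⊤) , φ , ∩-zeroˡ _ , φ-injective , sym ⊥∪∁∁ ,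
      λ X → trans (cong₂ (λ S r → rk S ∸ r) (∪-identityʳ _) rank-⊥) (ρ≡rankQ6 X)
      where open Q6Image φ abc-col ade-col bases-indep

-- Consequences of excluding Q₆

module WithoutQ6 {n : ℕ} (M : Matroid n) (r≡3 : r[ M ] ≡ 3) (no-Q6 : ¬ HasQ6Minor M) where
  open MatroidTheory M

  -- A point off two long lines abc and ade lies on one of the lines bd, be, cd, ce; otherwise
  -- the six points form Q₆.
  off-point-on-transversal : ∀ {a b c d e f} → TwoLongLines a b c d e → IsRep f →
    ¬ Collinear a b f → ¬ Collinear a d f →
    Collinear b d f ⊎ Collinear b e f ⊎ Collinear c d f ⊎ Collinear c e f
  off-point-on-transversal {a} {b} {c} {d} {e} {f} two@(line₁ , line₂ , ¬abd) rf ¬abf ¬adf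
    with collinear? b d f | collinear? b e f | collinear? c d f | collinear? c e f
  ... | yes bdf | _        | _        | _        = inj₁ bdf
  ... | no _    | yes bef  | _        | _        = inj₂ (inj₁ bef)
  ... | no _    | no _     | yes cdf  | _        = inj₂ (inj₂ (inj₁ cdf))
  ... | no _    | no _     | no _     | yes cef  = inj₂ (inj₂ (inj₂ cef))
  ... | no ¬bdf | no ¬bef  | no ¬cdf  | no ¬cef  = ⊥-elim (no-Q6 (q6-minor r≡3 φ abc-col ade-col bases-indep))
    where
    open LongLine line₁ using () renaming (indep₁₂ to a-b; indep₁₃ to a-c; indep₂₃ to b-c; collinear to abc-col)
    open LongLine line₂ using () renaming (indep₁₂ to a-d; indep₁₃ to a-e; indep₂₃ to d-e; collinear to ade-col)
    φ : Fin 6 → Fin n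
    φ = Data.Vec.lookup (a ∷ b ∷ c ∷ d ∷ e ∷ f ∷ [])
    ¬abe : ¬ Collinear a b e
    ¬abe = proj₂ (proj₂ (twoLongLines-swap₂ two))
    ¬adb : ¬ Collinear a d b
    ¬adb = ¬abd ∘ collinear-swap₂₃
    ¬adc : ¬ Collinear a d c
    ¬adc = proj₂ (proj₂ (twoLongLines-swap₁ two)) ∘ collinear-swap₂₃
    off-abc : ∀ {p q u} → Indep p q → Collinear a b p → Collinear a b q → ¬ Collinear a b u → ¬ Collinear p q u
    off-abc = ¬collinear-off-line a-b
    off-ade : ∀ {p q u} → Indep p q → Collinear a d p → Collinear a d q → ¬ Collinear a d u → ¬ Collinear p q u
    off-ade = ¬collinear-off-line a-d
    -- In the order of q6-bases: abd abe abf acd ace acf adf aef bcd bce bcf bde bdf bef cde cdf cef def.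
    bases-indep : All (λ (i , j , k) → ¬ Collinear (φ i) (φ j) (φ k)) q6-bases
    bases-indep =
      ¬abd ∷ ¬abe ∷ ¬abf ∷
      off-abc a-c collinear-xyx abc-col ¬abd ∷ off-abc a-c collinear-xyx abc-col ¬abe ∷
      off-abc a-c collinear-xyx abc-col ¬abf ∷ ¬adf ∷
      off-ade a-e collinear-xyx ade-col ¬adf ∷
      off-abc b-c collinear-xyy abc-col ¬abd ∷ off-abc b-c collinear-xyy abc-col ¬abe ∷
      off-abc b-c collinear-xyy abc-col ¬abf ∷
      off-ade d-e collinear-xyy ade-col ¬adb ∘ collinear-rotate ∷ ¬bdf ∷ ¬bef ∷
      off-ade d-e collinear-xyy ade-col ¬adc ∘ collinear-rotate ∷ ¬cdf ∷ ¬cef ∷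
      off-ade d-e collinear-xyy ade-col ¬adf ∷ []

  OnLine : Fin n → Fin n → Fin n → Set
  OnLine a p x = IsRep x × a ≢ x × Collinear a p x

  onLine? : ∀ a p x → Dec (OnLine a p x)
  onLine? a p x = isRep? x ×-dec ¬? (a ≟ᶠ x) ×-dec collinear? a p x

  -- The four points would give two long lines through a together with the line a y₁ y₂, and f
  -- would lie on transversals x yᵢ for two of them with the same yᵢ, putting yᵢ on the line a p.
  at-most-three-on-line : ∀ {a p y₁ y₂ f} → Indep a p → LongLine a y₁ y₂ → ¬ Collinear a p y₁ →
    IsRep f → ¬ Collinear a p f → ¬ Collinear a y₁ f →
    ∀ {x₁ x₂ x₃ x₄} → OnLine a p x₁ → OnLine a p x₂ → OnLine a p x₃ → OnLine a p x₄ →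
    ¬ (x₁ ≢ x₂ × x₁ ≢ x₃ × x₁ ≢ x₄ × x₂ ≢ x₃ × x₂ ≢ x₄ × x₃ ≢ x₄)
  at-most-three-on-line {a} {p} {y₁} {y₂} {f} a-p a-y₁-y₂@(longLine ra ry₁ ry₂ _ a≢y₂ _ ay₁y₂)
    ¬apy₁ rf ¬apf ¬ay₁f m₁ m₂ m₃ m₄ (d₁₂ , d₁₃ , d₁₄ , d₂₃ , d₂₄ , d₃₄) =
    no-monochromatic-pair (monochromatic-pair (λ x → collinear? x y₁ f ⊎-dec collinear? x y₂ f)
                             transversal-hit m₁ m₂ m₃ m₄ d₁₂ d₁₃ d₁₄ d₂₃ d₂₄ d₃₄)
    where
    off-line : ∀ {x u} → OnLine a p x → ¬ Collinear a p u → ¬ Collinear a x u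
    off-line (rx , a≢x , apx) ¬apu axu =
      ¬apu (collinear-on-line (rep-indep ra rx a≢x) (collinear-swap₂₃ apx) axu)

    transversal-hit : ∀ {x x′} → OnLine a p x → OnLine a p x′ → x ≢ x′ →
      (Collinear x y₁ f ⊎ Collinear x y₂ f) ⊎ (Collinear x′ y₁ f ⊎ Collinear x′ y₂ f)
    transversal-hit mx@(rx , a≢x , apx) mx′@(rx′ , a≢x′ , apx′) x≢x′
      with off-point-on-transversal
             (longLine ra rx rx′ a≢x a≢x′ x≢x′ (collinear-on-line a-p apx apx′) , a-y₁-y₂ , off-line mx ¬apy₁)
             rf (off-line mx ¬apf) ¬ay₁f
    ... | inj₁ h               = inj₁ (inj₁ h)
    ... | inj₂ (inj₁ h)        = inj₁ (inj₂ h)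
    ... | inj₂ (inj₂ (inj₁ h)) = inj₂ (inj₁ h)
    ... | inj₂ (inj₂ (inj₂ h)) = inj₂ (inj₂ h)

    meets-on-line : ∀ {y x x′} → Indep y f → OnLine a p x → OnLine a p x′ → x ≢ x′ →
                    Collinear x y f → Collinear x′ y f → Collinear a p y
    meets-on-line y-f (rx , _ , apx) (rx′ , _ , apx′) x≢x′ xyf x′yf =
      line-unique (rep-indep rx rx′ x≢x′) (line-unique a-p apx apx′ collinear-xyx)
        (line-unique a-p apx apx′ collinear-xyy)
        (line-unique y-f (collinear-rotate xyf) (collinear-rotate x′yf) collinear-xyx)

    no-monochromatic-pair : ¬ MonochromaticPair (OnLine a p) (λ x → Collinear x y₁ f) (λ x → Collinear x y₂ f)
    no-monochromatic-pair (x , x′ , mx , mx′ , x≢x′ , inj₁ (xy₁f , x′y₁f)) =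
      ¬apy₁ (meets-on-line (rep-indep ry₁ rf (λ { refl → ¬ay₁f collinear-xyy })) mx mx′ x≢x′ xy₁f x′y₁f)
    no-monochromatic-pair (x , x′ , mx , mx′ , x≢x′ , inj₂ (xy₂f , x′y₂f)) =
      ¬apy₁ (collinear-on-line (rep-indep ra ry₂ a≢y₂) (collinear-swap₂₃ apy₂) (collinear-swap₂₃ ay₁y₂))
      where
      apy₂ : Collinear a p y₂
      apy₂ = meets-on-line (rep-indep ry₂ rf (λ { refl → ¬ay₁f ay₁y₂ })) mx mx′ x≢x′ xy₂f x′y₂f

  OffLines : Fin n → Fin n → Fin n → Fin n → Set
  OffLines a b d s = IsRep s × ¬ Collinear a b s × ¬ Collinear a d s

  -- The line b d through b meets the long line b a c and misses e, so it carries at most three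
  -- points besides b, one of which is d.
  at-most-two-off-points : ∀ {a b c d e} → TwoLongLines a b c d e →
    ∀ {s₁ s₂ s₃} → OffLines a b d s₁ → OffLines a b d s₂ → OffLines a b d s₃ →
    Collinear b d s₁ → Collinear b d s₂ → Collinear b d s₃ → ¬ (s₁ ≢ s₂ × s₁ ≢ s₃ × s₂ ≢ s₃)
  at-most-two-off-points {a} {b} {c} {d} {e} two@(abc , ade , ¬abd) o₁ o₂ o₃ bds₁ bds₂ bds₃ (d₁₂ , d₁₃ , d₂₃) =
    at-most-three-on-line (rep-indep rb rd b≢d) (longLine-swap₁₂ abc)
      (¬abd ∘ collinear-⊆ ∈⁅··⁆₃ ∈⁅··⁆₁ ∈⁅··⁆₂) re ¬bde (¬abe ∘ collinear-swap₁₂)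
      (rd , b≢d , collinear-xyy) (on-bd o₁ bds₁) (on-bd o₂ bds₂) (on-bd o₃ bds₃)
      (d≢ o₁ , d≢ o₂ , d≢ o₃ , d₁₂ , d₁₃ , d₂₃)
    where
    open LongLine abc using () renaming (rep₂ to rb)
    open LongLine ade using () renaming (rep₂ to rd; rep₃ to re; indep₁₂ to a-d)
    b≢d : b ≢ d
    b≢d refl = ¬abd collinear-xyy
    ¬abe : ¬ Collinear a b e
    ¬abe = proj₂ (proj₂ (twoLongLines-swap₂ two))
    ¬bde : ¬ Collinear b d e
    ¬bde = ¬collinear-off-line a-d (LongLine.indep₂₃ ade) collinear-xyy (LongLine.collinear ade)
             (¬abd ∘ collinear-swap₂₃) ∘ collinear-rotate
    on-bd : ∀ {s} → OffLines a b d s → Collinear b d s → OnLine b d s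
    on-bd (rs , ¬abs , _) bds = rs , (λ { refl → ¬abs collinear-xyy }) , bds
    d≢ : ∀ {s} → OffLines a b d s → d ≢ s
    d≢ (_ , _ , ¬ads) refl = ¬ads collinear-xyy

-- Flat covers from lines spanned by pairs

-- Every point e contributes the flat cl (H e) if it represents its parallel class and cl ⁅ e ⁆
-- otherwise, and E contributes further flats.  The singleton flats cover every non-basis with a
-- loop or two parallel points, so it remains to span the long lines.
module FlatCover {n : ℕ} (M : Matroid n) (r≡3 : r[ M ] ≡ 3) (H : Fin n → Subset n)
                 (E : List (Subset n)) where
  open MatroidTheory M

  point-set : Fin n → Subset n
  point-set e with isRep? e
  ... | yes _ = H e
  ... | no  _ = ⁅ e ⁆

  generators : List (Subset n)
  generators = map point-set (allFin n) ++ E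

  SpansLine : Fin n → Fin n → Subset n → Set
  SpansLine x y Z = ∃[ u ] ∃[ v ] Z ≡ ⁅ u · v ⁆ × Indep u v × Collinear x y u × Collinear x y v

  LinesSpanned : Set
  LinesSpanned = ∀ {x y z} → LongLine x y z → Any (SpansLine x y) generators

  point-set∈generators : ∀ e → point-set e ∈ₗ generators
  point-set∈generators e = ∈-++⁺ˡ (∈-map⁺ point-set (∈-allFin e))

  spanned-by-point : ∀ {x y w} → IsRep w → SpansLine x y (H w) → Any (SpansLine x y) generators
  spanned-by-point {w = w} rw spans with isRep? w | point-set∈generators w
  ... | yes _  | ∈gens = lose ∈gens spans
  ... | no ¬rw | _     = ⊥-elim (¬rw rw)

  spanned-by-extra : ∀ {x y Z} → Z ∈ₗ E → SpansLine x y Z → Any (SpansLine x y) generators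
  spanned-by-extra Z∈E = lose (∈-++⁺ʳ (map point-set (allFin n)) Z∈E)

  module _ {X : Subset n} where

    CoveredBy : Subset n → Set
    CoveredBy Z = Covers M (cl Z) X

    covered-by-singleton : ∀ {e} → ¬ IsRep e → CoveredBy ⁅ e ⁆ → Any CoveredBy generators
    covered-by-singleton {e} ¬re covers with isRep? e | point-set∈generators e
    ... | yes re | _     = ⊥-elim (¬re re)
    ... | no _   | ∈gens = lose ∈gens covers

    covered-loop : ∀ {x} → x ∈ X → ¬ Nonloop x → Any CoveredBy generators
    covered-loop {x} x∈X ¬x≠0 = covered-by-singleton (¬x≠0 ∘ proj₁)
      (cl-covers (⁅⁆⊆ x∈X) X⊆cl[X] (subst (rk ⁅ x ⁆ <_) (sym (∣⁅x⁆∣≡1 x)) (≰⇒> ¬x≠0)))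

    -- Of two parallel points, the one of larger index is not a representative.
    covered-parallel< : ∀ {x y} → x ≢ y → x ∈ X → y ∈ X → Nonloop x → Nonloop y → Parallel x y →
                        x Data.Fin.< y → Any CoveredBy generators
    covered-parallel< {x} {y} x≢y x∈X y∈X x≠0 y≠0 x∥y x<y =
      covered-by-singleton (λ (_ , y-min) → indep⇒¬parallel (y-min x x<y x≠0) x∥y)
        (cl-covers (⁅·⁆⊆ x∈X y∈X) (⁅·⁆⊆ (∈-cl⁺ (≤-trans (parallel-sym x∥y) y≠0)) (X⊆cl[X] (x∈⁅x⁆ y)))
                   (≤-trans (s≤s (rank-⁅⁆ y)) (2≤∣p∣ x≢y ∈⁅·⁆ˡ ∈⁅·⁆ʳ)))

    covered-parallel : ∀ {x y} → x ≢ y → x ∈ X → y ∈ X → Nonloop x → Nonloop y → Parallel x y →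
                       Any CoveredBy generators
    covered-parallel {x} {y} x≢y x∈X y∈X x≠0 y≠0 x∥y with Finₚ.<-cmp x y
    ... | tri< x<y _ _ = covered-parallel< x≢y x∈X y∈X x≠0 y≠0 x∥y x<y
    ... | tri≈ _ x≡y _ = ⊥-elim (x≢y x≡y)
    ... | tri> _ _ y<x = covered-parallel< (x≢y ∘ sym) y∈X x∈X y≠0 x≠0 (parallel-sym x∥y) y<x

    covered-line : LinesSpanned → ∀ {x y z} → x ∈ X → y ∈ X → z ∈ X → Nonloop x → Nonloop y → Nonloop z →
                   Indep x y → Indep x z → Indep y z → Collinear x y z → Any CoveredBy generators
    covered-line spanned {x} {y} {z} x∈X y∈X z∈X x≠0 y≠0 z≠0 x-y x-z y-z xyz
      with rep-exists x≠0 | rep-exists y≠0 | rep-exists z≠0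
    ... | rx , Rx , rx∥x | ry , Ry , ry∥y | rz , Rz , rz∥z = Any.map covers (spanned rep-line)
      where
      on-xy : ∀ {w r} → Collinear x y w → Nonloop w → Parallel r w → Collinear x y r
      on-xy xyw w≠0 r∥w = collinear-parallel x-y xyw w≠0 (parallel-sym r∥w)
      xyrx : Collinear x y rx
      xyrx = on-xy collinear-xyx x≠0 rx∥x
      xyry : Collinear x y ry
      xyry = on-xy collinear-xyy y≠0 ry∥y
      xyrz : Collinear x y rz
      xyrz = on-xy xyz z≠0 rz∥z
      reps-distinct : ∀ {u v ru rv} → Indep u v → IsRep ru → Parallel ru u → Parallel rv v → ru ≢ rv
      reps-distinct u-v (ru≠0 , _) ru∥u rv∥v refl =
        indep⇒¬parallel u-v (parallel-trans ru≠0 (parallel-sym ru∥u) rv∥v)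
      rx≢ry : rx ≢ ry
      rx≢ry = reps-distinct x-y Rx rx∥x ry∥y
      rep-line : LongLine rx ry rz
      rep-line = longLine Rx Ry Rz rx≢ry (reps-distinct x-z Rx rx∥x rz∥z) (reps-distinct y-z Ry ry∥y rz∥z)
                          (line-unique x-y xyrx xyry xyrz)
      covers : ∀ {Z} → SpansLine rx ry Z → CoveredBy Z
      covers (u , v , refl , u-v , rxryu , rxryv) =
        cl-covers (⁅··⁆⊆ x∈X y∈X z∈X) (⁅··⁆⊆ (in-cl collinear-xyx) (in-cl collinear-xyy) (in-cl xyz))
          (≤-trans (s≤s (rank-⁅·⁆ u v)) (3≤∣p∣ (indep⇒≢ x-y) (indep⇒≢ x-z) (indep⇒≢ y-z) ∈⁅··⁆₁ ∈⁅··⁆₂ ∈⁅··⁆₃))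
        where
        in-cl : ∀ {w} → Collinear x y w → w ∈ cl ⁅ u · v ⁆
        in-cl xyw = ∈-cl⁺ (collinear⇒spans u-v
          (line-unique (rep-indep Rx Ry rx≢ry) rxryu rxryv (line-unique x-y xyrx xyry xyw)))

    covered-triple : LinesSpanned → ∀ {x y z} → x ≢ y → x ≢ z → y ≢ z → x ∈ X → y ∈ X → z ∈ X →
                     Collinear x y z → Any CoveredBy generators
    covered-triple spanned {x} {y} {z} x≢y x≢z y≢z x∈X y∈X z∈X xyz
      with nonloop? x | nonloop? y | nonloop? z
    ... | no ¬x≠0 | _       | _       = covered-loop x∈X ¬x≠0
    ... | yes _   | no ¬y≠0 | _       = covered-loop y∈X ¬y≠0
    ... | yes _   | yes _   | no ¬z≠0 = covered-loop z∈X ¬z≠0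
    ... | yes x≠0 | yes y≠0 | yes z≠0 with indep? x y | indep? x z | indep? y z
    ...   | no ¬x-y | _       | _       = covered-parallel x≢y x∈X y∈X x≠0 y≠0 (¬indep⇒parallel ¬x-y)
    ...   | yes _   | no ¬x-z | _       = covered-parallel x≢z x∈X z∈X x≠0 z≠0 (¬indep⇒parallel ¬x-z)
    ...   | yes _   | yes _   | no ¬y-z = covered-parallel y≢z y∈X z∈X y≠0 z≠0 (¬indep⇒parallel ¬y-z)
    ...   | yes x-y | yes x-z | yes y-z = covered-line spanned x∈X y∈X z∈X x≠0 y≠0 z≠0 x-y x-z y-z xyz

  flat-cover : LinesSpanned → ∀ {k} → length E ≤ k → κ≤ M (k + n)
  flat-cover spanned {k} ∣E∣≤k = map cl generators , (flats , covered) , length-bound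
    where
    flats : All (IsFlat M) (map cl generators)
    flats = Allₚ.map⁺ (All.universal cl-isFlat generators)

    covered : ∀ X → IsNonBasis M X → Any (λ F → Covers M F X) (map cl generators)
    covered X (∣X∣≡r , rX<∣X∣) with three-elements X (trans ∣X∣≡r r≡3)
    ... | x , y , z , x≢y , x≢z , y≢z , x∈X , y∈X , z∈X =
      Anyₚ.map⁺ (covered-triple spanned x≢y x≢z y≢z x∈X y∈X z∈X xyz)
      where
      xyz : Collinear x y z
      xyz = ≤-trans (rank-mono M (⁅··⁆⊆ x∈X y∈X z∈X))
                    (≤-pred (subst (rk X <_) (trans ∣X∣≡r r≡3) rX<∣X∣))

    length-bound : length (map cl generators) ≤ k + n
    length-bound = begin
      length (map cl generators)                   ≡⟨ length-map cl generators ⟩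
      length (map point-set (allFin n) ++ E)       ≡⟨ length-++ (map point-set (allFin n)) ⟩
      length (map point-set (allFin n)) + length E ≡⟨ cong (_+ length E) (trans (length-map point-set (allFin n))
                                                                               (length-tabulate id)) ⟩
      n + length E                                 ≤⟨ +-monoʳ-≤ n ∣E∣≤k ⟩
      n + k                                        ≡⟨ +-comm n k ⟩
      k + n                                        ∎
      where open ≤-Reasoning

-- Case 1: no two long lines meet in a point

module NoTwoLongLines {n : ℕ} (M : Matroid n) (r≡3 : r[ M ] ≡ 3)
       (no-two : ¬ (∃[ a ] ∃[ b ] ∃[ c ] ∃[ d ] ∃[ e ] MatroidTheory.TwoLongLines M a b c d e)) where
  open MatroidTheory M

  longLineAt? : ∀ x → Dec (∃[ y ] ∃[ z ] LongLine x y z)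
  longLineAt? x = Finₚ.any? λ y → Finₚ.any? λ z → longLine? x y z

  line-through : Fin n → Subset n
  line-through x with longLineAt? x
  ... | yes (y , _) = ⁅ x · y ⁆
  ... | no  _       = ⁅ x ⁆

  line-through-spec : ∀ {x y z} → LongLine x y z →
                      ∃[ y′ ] ∃[ z′ ] LongLine x y′ z′ × line-through x ≡ ⁅ x · y′ ⁆
  line-through-spec {x} xyz with longLineAt? x
  ... | yes (y′ , z′ , xy′z′) = y′ , z′ , xy′z′ , refl
  ... | no ¬∃                 = ⊥-elim (¬∃ (_ , _ , xyz))

  open FlatCover M r≡3 line-through []

  -- The recorded line through x is the given one, since otherwise the two would meet in x.
  lines-spanned : LinesSpanned
  lines-spanned {x} {y} {z} xyz@(longLine rx _ _ _ _ _ _) with line-through-spec xyz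
  ... | y′ , z′ , xy′z′ , line≡ with collinear? x y y′
  ...   | yes xyy′ = spanned-by-point rx (x , y′ , line≡ , LongLine.indep₁₂ xy′z′ , collinear-xyx , xyy′)
  ...   | no ¬xyy′ = ⊥-elim (no-two (x , y , z , y′ , z′ , xyz , xy′z′ , ¬xyy′))

  cover : ∀ {k} → κ≤ M (k + n)
  cover = flat-cover lines-spanned z≤n

-- Case 2: two long lines abc and ade meet in a

module TwoLongLinesMeet {n : ℕ} (M : Matroid n) (r≡3 : r[ M ] ≡ 3) (no-Q6 : ¬ HasQ6Minor M)
       {a b c d e : Fin n} (two : MatroidTheory.TwoLongLines M a b c d e) where
  open MatroidTheory M
  open WithoutQ6 M r≡3 no-Q6

  line₁ : LongLine a b c
  line₁ = proj₁ two

  line₂ : LongLine a d e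
  line₂ = proj₁ (proj₂ two)

  ¬abd : ¬ Collinear a b d
  ¬abd = proj₂ (proj₂ two)

  open LongLine line₁ using () renaming (rep₁ to ra; indep₁₂ to a-b)
  open LongLine line₂ using () renaming (indep₁₂ to a-d)

  Off : Fin n → Set
  Off = OffLines a b d

  off? : ∀ s → Dec (Off s)
  off? s = isRep? s ×-dec ¬? (collinear? a b s) ×-dec ¬? (collinear? a d s)

  L₁ L₂ S : List (Fin n)
  L₁ = filter (onLine? a b) (allFin n)
  L₂ = filter (onLine? a d) (allFin n)
  S  = filter off? (allFin n)

  -- The lines joining a point of abc to a point of ade are needed only for long lines through a
  -- point off both, and only then are abc and ade known to be short.
  crossings : List (Fin n) → List (Subset n)
  crossings []      = []
  crossings (_ ∷ _) = cartesianProductWith ⁅_·_⁆ L₁ L₂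

  extra : List (Subset n)
  extra = pairsWith ⁅_·_⁆ S ++ crossings S

  open FlatCover M r≡3 (λ r → ⁅ a · r ⁆) extra

  ∈S : ∀ {s} → Off s → s ∈ₗ S
  ∈S = ∈-filter⁺ off? (∈-allFin _)

  length-L₁ : ∀ {f} → Off f → length L₁ ≤ 3
  length-L₁ (rf , ¬abf , ¬adf) = Unique-length≤3 (filter-allFin-unique (onLine? a b)) λ m₁ m₂ m₃ m₄ →
    at-most-three-on-line a-b line₂ ¬abd rf ¬abf ¬adf (on m₁) (on m₂) (on m₃) (on m₄)
    where
    on : ∀ {x} → x ∈ₗ L₁ → OnLine a b x
    on = ∈-filter-allFin⁻ (onLine? a b)

  length-L₂ : ∀ {f} → Off f → length L₂ ≤ 3
  length-L₂ (rf , ¬abf , ¬adf) = Unique-length≤3 (filter-allFin-unique (onLine? a d)) λ m₁ m₂ m₃ m₄ →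
    at-most-three-on-line a-d line₁ (¬abd ∘ collinear-swap₂₃) rf ¬adf ¬abf (on m₁) (on m₂) (on m₃) (on m₄)
    where
    on : ∀ {x} → x ∈ₗ L₂ → OnLine a d x
    on = ∈-filter-allFin⁻ (onLine? a d)

  OffOn : Fin n → Fin n → Fin n → Set
  OffOn u v s = Off s × Collinear u v s

  offOn? : ∀ u v s → Dec (OffOn u v s)
  offOn? u v s = off? s ×-dec collinear? u v s

  length-offOn : ∀ {b′ c′ d′ e′} → TwoLongLines a b′ c′ d′ e′ → (∀ {s} → Off s → OffLines a b′ d′ s) →
                 length (filter (offOn? b′ d′) (allFin n)) ≤ 2
  length-offOn {b′} {d′ = d′} two′ off′ = Unique-length≤2 (filter-allFin-unique (offOn? b′ d′)) λ m₁ m₂ m₃ →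
    at-most-two-off-points two′ (off′ (proj₁ (on m₁))) (off′ (proj₁ (on m₂))) (off′ (proj₁ (on m₃)))
      (proj₂ (on m₁)) (proj₂ (on m₂)) (proj₂ (on m₃))
    where
    on : ∀ {s} → s ∈ₗ filter (offOn? b′ d′) (allFin n) → OffOn b′ d′ s
    on = ∈-filter-allFin⁻ (offOn? b′ d′)

  -- Every point off both long lines lies on one of the four lines bd, be, cd, ce, each of which
  -- carries at most two such points.
  length-S : length S ≤ 8
  length-S =
    ≤-trans (length-filter-⊎ off? (offOn? b d) be⊎cd⊎ce? transversal (allFin n)) (+-mono-≤ (length-offOn two id)
    (≤-trans (length-filter-⊎ be⊎cd⊎ce? (offOn? b e) cd⊎ce? id (allFin n)) (+-mono-≤ (length-offOn two₂ to-ae)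
    (≤-trans (length-filter-⊎ cd⊎ce? (offOn? c d) (offOn? c e) id (allFin n)) (+-mono-≤ (length-offOn two₁ to-ac)
    (length-offOn (twoLongLines-swap₂ two₁) (to-ac ∘ to-ae)))))))
    where
    two₁ : TwoLongLines a c b d e
    two₁ = twoLongLines-swap₁ two
    two₂ : TwoLongLines a b c e d
    two₂ = twoLongLines-swap₂ two
    cd⊎ce? : Decidable (λ s → OffOn c d s ⊎ OffOn c e s)
    cd⊎ce? s = offOn? c d s ⊎-dec offOn? c e s
    be⊎cd⊎ce? : Decidable (λ s → OffOn b e s ⊎ OffOn c d s ⊎ OffOn c e s)
    be⊎cd⊎ce? s = offOn? b e s ⊎-dec cd⊎ce? s
    transversal : ∀ {s} → Off s → OffOn b d s ⊎ OffOn b e s ⊎ OffOn c d s ⊎ OffOn c e s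
    transversal o@(rs , ¬abs , ¬ads) with off-point-on-transversal two rs ¬abs ¬ads
    ... | inj₁ bds               = inj₁ (o , bds)
    ... | inj₂ (inj₁ bes)        = inj₂ (inj₁ (o , bes))
    ... | inj₂ (inj₂ (inj₁ cds)) = inj₂ (inj₂ (inj₁ (o , cds)))
    ... | inj₂ (inj₂ (inj₂ ces)) = inj₂ (inj₂ (inj₂ (o , ces)))
    to-ae : ∀ {b′ s} → OffLines a b′ d s → OffLines a b′ e s
    to-ae (rs , ¬ab′s , ¬ads) = rs , ¬ab′s , ¬ads ∘ longLine-same line₂
    to-ac : ∀ {d′ s} → OffLines a b d′ s → OffLines a c d′ s
    to-ac (rs , ¬abs , ¬ad′s) = rs , ¬abs ∘ longLine-same line₁ , ¬ad′s

  length-crossings : ∀ xs → (∀ {s} → s ∈ₗ xs → Off s) → length (crossings xs) ≤ 9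
  length-crossings []      _   = z≤n
  length-crossings (s ∷ _) off = begin
    length (cartesianProductWith ⁅_·_⁆ L₁ L₂) ≡⟨ length-cartesianProductWith ⁅_·_⁆ L₁ L₂ ⟩
    length L₁ * length L₂                    ≤⟨ *-mono-≤ (length-L₁ (off (here refl))) (length-L₂ (off (here refl))) ⟩
    9                                        ∎
    where open ≤-Reasoning

  length-extra : length extra ≤ 41
  length-extra = begin
    length extra                                     ≡⟨ length-++ (pairsWith ⁅_·_⁆ S) ⟩
    length (pairsWith ⁅_·_⁆ S) + length (crossings S) ≡⟨ cong (_+ length (crossings S)) (length-pairsWith ⁅_·_⁆ S) ⟩
    length S C 2 + length (crossings S)              ≤⟨ +-mono-≤ (C2-mono length-S)
                                                          (length-crossings S (∈-filter-allFin⁻ off?)) ⟩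
    8 C 2 + 9                                        ≤⟨ m≤m+n 37 4 ⟩
    41                                               ∎
    where open ≤-Reasoning

  module AvoidingA {r₁ r₂ : Fin n} (r₁-r₂ : Indep r₁ r₂) (¬r₁r₂a : ¬ Collinear r₁ r₂ a) where

    OnR₁R₂ : Fin n → Set
    OnR₁R₂ r = IsRep r × Collinear r₁ r₂ r

    a≢ : ∀ {r} → OnR₁R₂ r → a ≢ r
    a≢ (_ , r₁r₂r) refl = ¬r₁r₂a r₁r₂r

    classify : ∀ {r} → OnR₁R₂ r → ¬ Off r → OnLine a b r ⊎ OnLine a d r
    classify {r} on@(rr , _) ¬off with collinear? a b r | collinear? a d r
    ... | yes abr | _       = inj₁ (rr , a≢ on , abr)
    ... | no _    | yes adr = inj₂ (rr , a≢ on , adr)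
    ... | no ¬abr | no ¬adr = ⊥-elim (¬off (rr , ¬abr , ¬adr))

    -- Two points of the line r₁ r₂ on a line through a would put a on r₁ r₂.
    ¬two-on : ∀ {x p q} → Indep a x → OnR₁R₂ p → OnR₁R₂ q → p ≢ q → ¬ (OnLine a x p × OnLine a x q)
    ¬two-on a-x (rp , r₁r₂p) (rq , r₁r₂q) p≢q ((_ , _ , axp) , (_ , _ , axq)) = ¬r₁r₂a
      (line-unique (rep-indep rp rq p≢q) (line-unique r₁-r₂ r₁r₂p r₁r₂q collinear-xyx)
        (line-unique r₁-r₂ r₁r₂p r₁r₂q collinear-xyy) (line-unique a-x axp axq collinear-xyx))

    spans : ∀ {p q} → OnR₁R₂ p → OnR₁R₂ q → p ≢ q → SpansLine r₁ r₂ ⁅ p · q ⁆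
    spans (rp , r₁r₂p) (rq , r₁r₂q) p≢q = _ , _ , refl , rep-indep rp rq p≢q , r₁r₂p , r₁r₂q

    spanned-by-two-off : ∀ {s s′} → OnR₁R₂ s → OnR₁R₂ s′ → s ≢ s′ → Off s → Off s′ →
                         Any (SpansLine r₁ r₂) generators
    spanned-by-two-off on on′ s≢s′ off off′ with ∈-pairsWith ⁅_·_⁆ (∈S off) (∈S off′) s≢s′
    ... | inj₁ ss′∈ = spanned-by-extra (∈-++⁺ˡ ss′∈) (spans on on′ s≢s′)
    ... | inj₂ s′s∈ = spanned-by-extra (∈-++⁺ˡ s′s∈) (spans on′ on (s≢s′ ∘ sym))

    crossing∈ : ∀ {xs s p q} → s ∈ₗ xs → OnLine a b p → OnLine a d q → ⁅ p · q ⁆ ∈ₗ crossings xs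
    crossing∈ {_ ∷ _} _ abp adq =
      ∈-cartesianProductWith⁺ ⁅_·_⁆ (∈-filter⁺ (onLine? a b) (∈-allFin _) abp) (∈-filter⁺ (onLine? a d) (∈-allFin _) adq)

    spanned-by-crossing : ∀ {p q s} → OnR₁R₂ p → OnR₁R₂ q → p ≢ q → ¬ Off p → ¬ Off q → Off s →
                          Any (SpansLine r₁ r₂) generators
    spanned-by-crossing on-p on-q p≢q ¬off-p ¬off-q off-s with classify on-p ¬off-p | classify on-q ¬off-q
    ... | inj₁ abp | inj₁ abq = ⊥-elim (¬two-on a-b on-p on-q p≢q (abp , abq))
    ... | inj₂ adp | inj₂ adq = ⊥-elim (¬two-on a-d on-p on-q p≢q (adp , adq))
    ... | inj₁ abp | inj₂ adq = spanned-by-extra (∈-++⁺ʳ _ (crossing∈ (∈S off-s) abp adq)) (spans on-p on-q p≢q)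
    ... | inj₂ adp | inj₁ abq =
      spanned-by-extra (∈-++⁺ʳ _ (crossing∈ (∈S off-s) abq adp)) (spans on-q on-p (p≢q ∘ sym))

    -- Among three points of r₁ r₂ at most one lies on each long line through a.
    spanned : ∀ {r₃} → OnR₁R₂ r₁ → OnR₁R₂ r₂ → OnR₁R₂ r₃ → r₁ ≢ r₂ → r₁ ≢ r₃ → r₂ ≢ r₃ → Any (SpansLine r₁ r₂) generators
    spanned {r₃} o₁ o₂ o₃ d₁₂ d₁₃ d₂₃ with off? r₁ | off? r₂ | off? r₃
    ... | yes off₁ | yes off₂ | _        = spanned-by-two-off o₁ o₂ d₁₂ off₁ off₂
    ... | yes off₁ | no _     | yes off₃ = spanned-by-two-off o₁ o₃ d₁₃ off₁ off₃
    ... | no _     | yes off₂ | yes off₃ = spanned-by-two-off o₂ o₃ d₂₃ off₂ off₃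
    ... | no ¬off₁ | no ¬off₂ | yes off₃ = spanned-by-crossing o₁ o₂ d₁₂ ¬off₁ ¬off₂ off₃
    ... | no ¬off₁ | yes off₂ | no ¬off₃ = spanned-by-crossing o₁ o₃ d₁₃ ¬off₁ ¬off₃ off₂
    ... | yes off₁ | no ¬off₂ | no ¬off₃ = spanned-by-crossing o₂ o₃ d₂₃ ¬off₂ ¬off₃ off₁
    ... | no ¬off₁ | no ¬off₂ | no ¬off₃ with
          pair-among-three o₁ o₂ o₃ d₁₂ d₁₃ d₂₃ (classify o₁ ¬off₁) (classify o₂ ¬off₂) (classify o₃ ¬off₃)
    ...   | _ , _ , on , on′ , ≢′ , inj₁ ab = ⊥-elim (¬two-on a-b on on′ ≢′ ab)
    ...   | _ , _ , on , on′ , ≢′ , inj₂ ad = ⊥-elim (¬two-on a-d on on′ ≢′ ad)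

  lines-spanned : LinesSpanned
  lines-spanned {r₁} {r₂} (longLine R₁ R₂ R₃ d₁₂ d₁₃ d₂₃ r₁r₂r₃) with collinear? r₁ r₂ a | a ≟ᶠ r₁
  ... | yes r₁r₂a | no a≢r₁ = spanned-by-point R₁ (a , r₁ , refl , rep-indep ra R₁ a≢r₁ , r₁r₂a , collinear-xyx)
  ... | yes r₁r₂a | yes refl = spanned-by-point R₂ (a , r₂ , refl , rep-indep ra R₂ d₁₂ , r₁r₂a , collinear-xyy)
  ... | no ¬r₁r₂a | _ = AvoidingA.spanned (rep-indep R₁ R₂ d₁₂) ¬r₁r₂a
                          (R₁ , collinear-xyx) (R₂ , collinear-xyy) (R₃ , r₁r₂r₃) d₁₂ d₁₃ d₂₃

  cover : κ≤ M (41 + n)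
  cover = flat-cover lines-spanned length-extra

lemma4p6 : (n : ℕ) (M : Matroid n) → r[ M ] ≡ 3 → ¬ HasQ6Minor M →
    κ≤ M (41 + n)
lemma4p6 n M r≡3 no-Q6 with MatroidTheory.twoLongLines? M
... | yes (_ , _ , _ , _ , _ , two) = TwoLongLinesMeet.cover M r≡3 no-Q6 two
... | no no-two                     = NoTwoLongLines.cover M r≡3 no-two
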